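{- Let $\mathcal{C}$ be an elementary topos and let $\phi\colon L\to A$ be an arrow in $\mathcal{C}$. Let $\eta_\phi\colon \phi\to F(\phi)$, with $F(\phi)\colon \bar{A}\to A$, be the partial map classifier of $\phi$ (regarded as an object of the slice category $\mathcal{C}\downarrow A$) in the slice category $\mathcal{C}\downarrow A$, which is again a topos. Then $L\xrightarrow{\eta_\phi}\bar{A}\xrightarrow{F(\phi)}A$ is the materialization of $\phi$, i.e. it is a terminal object of the materialization category $\mathrm{Mat}(\phi)$; in particular the materialization exists and its middle object is $\bar{A}$.
   Context: The materialization category $\mathrm{Mat}(\phi)$ of an arrow $\phi\colon L\to A$ has as objects all factorizations $L\xrightarrow{m}X\xrightarrow{\psi}A$ of $\phi$ (so $\psi\circ m=\phi$) with $m$ a mono. An arrow from $L\xrightarrow{m}X\xrightarrow{\psi}A$ to $L\xrightarrow{m'}Y\xrightarrow{\psi'}A$ is an arrow $f\colon X\to Y$ of $\mathcal{C}$ with $\psi'\circ f=\psi$ and such that the square with sides $m\colon L\to X$, $\mathrm{id}_L\colon L\to L$, $f\colon X\to Y$, $m'\colon L\to Y$ (so $f\circ m=m'\circ \mathrm{id}_L$) is a pullback. If $\mathrm{Mat}(\phi)$ has a terminal object, it is called the materialization of $\phi$. A partial map classifier in a category assigns to each object $Z$ a mono $\eta_Z\colon Z\rightarrowtail F(Z)$ such that for every span $X\leftarrowtail U\to Z$ with left leg mono there is a unique arrow $X\to F(Z)$ making the evident square a pullback. -}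

module Defs where

open import Level using (Level; _⊔_) renaming (suc to lsuc)
open import Data.Product using (Σ; _×_; _,_; proj₁; proj₂)
open import Relation.Binary using (IsEquivalence)

record Category (o ℓ e : Level) : Set (lsuc (o ⊔ ℓ ⊔ e)) where
  infixr 9 _∘_
  infix 4 _≈_
  infix 4 _⇒_
  field
    Obj : Set o
    _⇒_ : Obj → Obj → Set ℓ
    _≈_ : ∀ {A B} → A ⇒ B → A ⇒ B → Set e
    ≈-equiv : ∀ {A B} → IsEquivalence (_≈_ {A} {B})
    id : ∀ {A} → A ⇒ A
    _∘_ : ∀ {A B C} → B ⇒ C → A ⇒ B → A ⇒ C
    assoc : ∀ {A B C D} {f : A ⇒ B} {g : B ⇒ C} {h : C ⇒ D} →
            (h ∘ g) ∘ f ≈ h ∘ (g ∘ f)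
    identityˡ : ∀ {A B} {f : A ⇒ B} → id ∘ f ≈ f
    identityʳ : ∀ {A B} {f : A ⇒ B} → f ∘ id ≈ f
    ∘-resp-≈ : ∀ {A B C} {f h : B ⇒ C} {g i : A ⇒ B} →
               f ≈ h → g ≈ i → f ∘ g ≈ h ∘ i

module _ {o ℓ e : Level} (C : Category o ℓ e) where
  open Category C

  Mono : ∀ {X Y} → X ⇒ Y → Set (o ⊔ ℓ ⊔ e)
  Mono {X} f = ∀ {Z} (g h : Z ⇒ X) → f ∘ g ≈ f ∘ h → g ≈ h

  record IsPullback {P X Y Z : Obj} (p₁ : P ⇒ X) (p₂ : P ⇒ Y)
                    (f : X ⇒ Z) (g : Y ⇒ Z) : Set (o ⊔ ℓ ⊔ e) where
    field
      commute : f ∘ p₁ ≈ g ∘ p₂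
      universal : ∀ {Q} (q₁ : Q ⇒ X) (q₂ : Q ⇒ Y) → f ∘ q₁ ≈ g ∘ q₂ →
        Σ (Q ⇒ P) λ u → (p₁ ∘ u ≈ q₁) × (p₂ ∘ u ≈ q₂) ×
          (∀ (v : Q ⇒ P) → p₁ ∘ v ≈ q₁ → p₂ ∘ v ≈ q₂ → v ≈ u)

  IsTerminal : Obj → Set (o ⊔ ℓ ⊔ e)
  IsTerminal T = ∀ X → Σ (X ⇒ T) λ ! → ∀ (g : X ⇒ T) → g ≈ !

  record Product (X Y : Obj) : Set (o ⊔ ℓ ⊔ e) where
    field
      obj : Obj
      π₁ : obj ⇒ X
      π₂ : obj ⇒ Y
      ⟨_,_⟩ : ∀ {Z} → Z ⇒ X → Z ⇒ Y → Z ⇒ obj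
      project₁ : ∀ {Z} {f : Z ⇒ X} {g : Z ⇒ Y} → π₁ ∘ ⟨ f , g ⟩ ≈ f
      project₂ : ∀ {Z} {f : Z ⇒ X} {g : Z ⇒ Y} → π₂ ∘ ⟨ f , g ⟩ ≈ g
      unique : ∀ {Z} {f : Z ⇒ X} {g : Z ⇒ Y} (h : Z ⇒ obj) →
               π₁ ∘ h ≈ f → π₂ ∘ h ≈ g → h ≈ ⟨ f , g ⟩

  record IsElementaryTopos : Set (o ⊔ ℓ ⊔ e) where
    field
      ⊤ : Obj
      ⊤-terminal : IsTerminal ⊤
      pullback : ∀ {X Y Z} (f : X ⇒ Z) (g : Y ⇒ Z) →
        Σ Obj λ P → Σ (P ⇒ X) λ p₁ → Σ (P ⇒ Y) λ p₂ → IsPullback p₁ p₂ f g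
      product : ∀ X Y → Product X Y
    _⁂id : ∀ {Z E X} → Z ⇒ E → Product.obj (product Z X) ⇒ Product.obj (product E X)
    _⁂id {Z} {E} {X} h =
      Product.⟨_,_⟩ (product E X) (h ∘ Product.π₁ (product Z X)) (Product.π₂ (product Z X))
    field
      exponential : ∀ (X Y : Obj) →
        Σ Obj λ E → Σ (Product.obj (product E X) ⇒ Y) λ ev →
          ∀ Z (f : Product.obj (product Z X) ⇒ Y) →
            Σ (Z ⇒ E) λ h → (ev ∘ (h ⁂id) ≈ f) ×
              (∀ (h' : Z ⇒ E) → ev ∘ (h' ⁂id) ≈ f → h' ≈ h)
      Ω : Obj
      true : ⊤ ⇒ Ω
      classify : ∀ {U X} (m : U ⇒ X) → Mono m →
        Σ (X ⇒ Ω) λ χ → IsPullback m (proj₁ (⊤-terminal U)) χ true ×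
          (∀ (χ' : X ⇒ Ω) → IsPullback m (proj₁ (⊤-terminal U)) χ' true → χ' ≈ χ)

  record PartialMapClassifier (Z : Obj) : Set (o ⊔ ℓ ⊔ e) where
    field
      F : Obj
      η : Z ⇒ F
      η-mono : Mono η
      classifyPartial : ∀ {X U} (m : U ⇒ X) (f : U ⇒ Z) → Mono m →
        Σ (X ⇒ F) λ χ → IsPullback m f χ η ×
          (∀ (χ' : X ⇒ F) → IsPullback m f χ' η → χ' ≈ χ)

  record MatObj {L A : Obj} (φ : L ⇒ A) : Set (o ⊔ ℓ ⊔ e) where
    field
      X : Obj
      m : L ⇒ X
      ψ : X ⇒ A
      factor : ψ ∘ m ≈ φ
      mono : Mono m

  MatHom : ∀ {L A} {φ : L ⇒ A} → MatObj φ → MatObj φ → Set (o ⊔ ℓ ⊔ e)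
  MatHom M N = Σ (MatObj.X M ⇒ MatObj.X N) λ f →
    (MatObj.ψ N ∘ f ≈ MatObj.ψ M) × IsPullback (MatObj.m M) id f (MatObj.m N)

  -- Terminal object of Mat(φ); arrows of Mat(φ) are equal iff their
  -- underlying arrows of C are equal.
  IsTerminalMat : ∀ {L A} (φ : L ⇒ A) → MatObj φ → Set (o ⊔ ℓ ⊔ e)
  IsTerminalMat φ T = ∀ (M : MatObj φ) → Σ (MatHom M T) λ h →
    ∀ (h' : MatHom M T) → proj₁ h' ≈ proj₁ h

module _ {o ℓ e : Level} (C : Category o ℓ e) where
  open Category C
  private module E {A B} = IsEquivalence (≈-equiv {A} {B})

  Slice : Obj → Category (o ⊔ ℓ) (ℓ ⊔ e) e
  Slice A = record
    { Obj = Σ Obj λ X → X ⇒ A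
    ; _⇒_ = λ x y → Σ (proj₁ x ⇒ proj₁ y) λ f → proj₂ y ∘ f ≈ proj₂ x
    ; _≈_ = λ f g → proj₁ f ≈ proj₁ g
    ; ≈-equiv = record { refl = E.refl ; sym = E.sym ; trans = E.trans }
    ; id = id , identityʳ
    ; _∘_ = λ g f → (proj₁ g ∘ proj₁ f) ,
        E.trans (E.sym assoc) (E.trans (∘-resp-≈ (proj₂ g) E.refl) (proj₂ f))
    ; assoc = assoc
    ; identityˡ = identityˡ
    ; identityʳ = identityʳ
    ; ∘-resp-≈ = ∘-resp-≈
    }

classifierMatObj : ∀ {o ℓ e} (C : Category o ℓ e) {L A : Category.Obj C}
  (φ : Category._⇒_ C L A) (P : PartialMapClassifier (Slice C A) (L , φ)) →
  Mono C (proj₁ (PartialMapClassifier.η P)) → MatObj C φ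
classifierMatObj C φ P mono = record
  { X = proj₁ (PartialMapClassifier.F P)
  ; m = proj₁ (PartialMapClassifier.η P)
  ; ψ = proj₂ (PartialMapClassifier.F P)
  ; factor = proj₂ (PartialMapClassifier.η P)
  ; mono = mono
  }

{-# OPTIONS --safe #-}
-- Monos L ↣ X over A are exactly the objects of Mat(φ), and a pullback square
-- in C ↓ A is exactly a pullback square in C whose arrows live over A.  So a
-- terminal object of Mat(φ) is a mono η : (L , φ) ↣ F in C ↓ A through which
-- every mono out of (L , φ) factors by a unique pullback square with the
-- identity on (L , φ): precisely the universal property of the partial map
-- classifier, read at the total partial maps (m , id).
module Submission where

open import Defs
open import Data.Product using (Σ; _,_; proj₁; proj₂)
open import Relation.Binary using (IsEquivalence)

module SliceProperties {o ℓ e} (C : Category o ℓ e) (A : Category.Obj C) where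
  open Category C
  private
    module S = Category (Slice C A)
    module ≈ {X Y} = IsEquivalence (≈-equiv {X} {Y})

  over-∘ : ∀ {X Y : S.Obj} {Q} (f : X S.⇒ Y) (a : Q ⇒ proj₁ X) →
           proj₂ X ∘ a ≈ proj₂ Y ∘ (proj₁ f ∘ a)
  over-∘ f a = ≈.trans (∘-resp-≈ (≈.sym (proj₂ f)) ≈.refl) assoc

  over-≈ : ∀ {X Y Z : S.Obj} {Q} (f : X S.⇒ Z) (g : Y S.⇒ Z)
             {a : Q ⇒ proj₁ X} {b : Q ⇒ proj₁ Y} →
           proj₁ f ∘ a ≈ proj₁ g ∘ b → proj₂ X ∘ a ≈ proj₂ Y ∘ b
  over-≈ f g {a} {b} fa≈gb =
    ≈.trans (over-∘ f a) (≈.trans (∘-resp-≈ ≈.refl fa≈gb) (≈.sym (over-∘ g b)))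

  mono⇒slice-mono : ∀ {X Y : S.Obj} (f : X S.⇒ Y) →
                    Mono C (proj₁ f) → Mono (Slice C A) f
  mono⇒slice-mono f mono g h = mono (proj₁ g) (proj₁ h)

  slice-mono⇒mono : ∀ {X Y : S.Obj} (f : X S.⇒ Y) →
                    Mono (Slice C A) f → Mono C (proj₁ f)
  slice-mono⇒mono f mono g h fg≈fh =
    mono (g , ≈.refl) (h , over-≈ f f (≈.sym fg≈fh)) fg≈fh

  slice-pullback⇒pullback :
    ∀ {P X Y Z : S.Obj} {p₁ : P S.⇒ X} {p₂ : P S.⇒ Y} {f : X S.⇒ Z} {g : Y S.⇒ Z} →
    IsPullback (Slice C A) p₁ p₂ f g →
    IsPullback C (proj₁ p₁) (proj₁ p₂) (proj₁ f) (proj₁ g)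
  slice-pullback⇒pullback {X = X} {p₁ = p₁} {f = f} {g} pb = record
    { commute = IsPullback.commute pb
    ; universal = λ q₁ q₂ commutes →
        let (u , _) , p₁u≈q₁ , p₂u≈q₂ , unique =
              IsPullback.universal pb {Q = _ , proj₂ X ∘ q₁}
                (q₁ , ≈.refl) (q₂ , over-≈ g f (≈.sym commutes)) commutes
        in u , p₁u≈q₁ , p₂u≈q₂ , λ v p₁v≈q₁ →
             unique (v , ≈.trans (over-∘ p₁ v) (∘-resp-≈ ≈.refl p₁v≈q₁)) p₁v≈q₁
    }

  pullback⇒slice-pullback :
    ∀ {P X Y Z : S.Obj} {p₁ : P S.⇒ X} {p₂ : P S.⇒ Y} {f : X S.⇒ Z} {g : Y S.⇒ Z} →
    IsPullback C (proj₁ p₁) (proj₁ p₂) (proj₁ f) (proj₁ g) →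
    IsPullback (Slice C A) p₁ p₂ f g
  pullback⇒slice-pullback {p₁ = p₁} pb = record
    { commute = IsPullback.commute pb
    ; universal = λ q₁ q₂ commutes →
        let u , p₁u≈q₁ , p₂u≈q₂ , unique =
              IsPullback.universal pb (proj₁ q₁) (proj₁ q₂) commutes
        in (u , ≈.trans (over-∘ p₁ u) (≈.trans (∘-resp-≈ ≈.refl p₁u≈q₁) (proj₂ q₁))) ,
           p₁u≈q₁ , p₂u≈q₂ , λ v → unique (proj₁ v)
    }

module _ {o ℓ e} (C : Category o ℓ e) {L A : Category.Obj C}
         (φ : Category._⇒_ C L A) where
  open SliceProperties C A
  private module S = Category (Slice C A)

  classifierMatObj-terminal : (P : PartialMapClassifier (Slice C A) (L , φ))
    (mono : Mono C (proj₁ (PartialMapClassifier.η P))) →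
    IsTerminalMat C φ (classifierMatObj C φ P mono)
  classifierMatObj-terminal P mono M =
    let χ , χ-pullback , χ-unique =
          classifyPartial m-over S.id (mono⇒slice-mono m-over (MatObj.mono M))
    in (proj₁ χ , proj₂ χ , slice-pullback⇒pullback χ-pullback) ,
       λ (f , f-over , f-pullback) →
         χ-unique (f , f-over) (pullback⇒slice-pullback f-pullback)
    where
    open PartialMapClassifier P using (classifyPartial)
    open MatObj M using (X; m; ψ; factor)
    m-over : (L , φ) S.⇒ (X , ψ)
    m-over = m , factor

proposition8 : ∀ {o ℓ e} (C : Category o ℓ e) → IsElementaryTopos C →
    ∀ {L A : Category.Obj C} (φ : Category._⇒_ C L A)
    (P : PartialMapClassifier (Slice C A) (L , φ)) →
    Σ (Mono C (proj₁ (PartialMapClassifier.η P))) λ mono →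
    IsTerminalMat C φ (classifierMatObj C φ P mono)
proposition8 C _ {A = A} φ P = η-mono , classifierMatObj-terminal C φ P η-mono
  where
  η-mono : Mono C (proj₁ (PartialMapClassifier.η P))
  η-mono = SliceProperties.slice-mono⇒mono C A (PartialMapClassifier.η P)
             (PartialMapClassifier.η-mono P)
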